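{- Let $\mathfrak{tm}=\mu_{\mathrm{TM}}^{\omega}(0)=0110100110010110\cdots$ be the Thue–Morse word. Then $11\mathfrak{tm}$ is prefix normal, whereas $1\mathfrak{tm}$ is not prefix normal.
   Context: $\mu_{\mathrm{TM}}$ is the morphism $0\mapsto01$, $1\mapsto10$, and $\mu_{\mathrm{TM}}^{\omega}(0)$ is its fixed point starting with $0$. Binary words are indexed from $1$; $P_w(i)$ is the number of $1$s in the prefix of length $i$ of $w$. An infinite binary word $w$ is prefix normal if for every $i\ge1$ every factor of $w$ of length $i$ has at most $P_w(i)$ ones. -}

module Defs where

open import Data.Bool using (Bool; true; false)
open import Data.Nat using (ℕ; zero; suc; _+_; _≤_; _∸_)
open import Data.List using (List; []; _∷_; _++_; concatMap; length)
open import Data.Maybe using (Maybe; just; nothing; fromMaybe)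

-- Binary letters: false = 0, true = 1.
-- Infinite binary words: functions ℕ → Bool, where the letter at
-- (1-based) position i is  w (i ∸ 1), i.e. w 0 is the first letter.
Word : Set
Word = ℕ → Bool

μTM-letter : Bool → List Bool
μTM-letter false = false ∷ true ∷ []
μTM-letter true  = true ∷ false ∷ []

μTM : List Bool → List Bool
μTM = concatMap μTM-letter

μTM^ : ℕ → List Bool
μTM^ zero    = false ∷ []
μTM^ (suc k) = μTM (μTM^ k)

-- 0-based lookup in a finite word (default 0 when out of range; never used
-- out of range below since |μ_TM^(n+1)(0)| = 2^(n+1) > n).
index : List Bool → ℕ → Bool
index []       _       = false
index (x ∷ xs) zero    = x
index (x ∷ xs) (suc n) = index xs n

-- The Thue–Morse word tm = μ_TM^ω(0): its letter at 0-based position n is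
-- the letter at position n of the prefix μ_TM^(n+1)(0) of the fixed point.
tm : Word
tm n = index (μTM^ (suc n)) n

_∷ʷ_ : Bool → Word → Word
(a ∷ʷ w) zero    = a
(a ∷ʷ w) (suc n) = w n

infixr 5 _∷ʷ_

bit : Bool → ℕ
bit false = 0
bit true  = 1

ones : Word → ℕ → ℕ → ℕ
ones w j zero    = 0
ones w j (suc i) = bit (w j) + ones w (suc j) i

P : Word → ℕ → ℕ
P w i = ones w 0 i

PrefixNormal : Word → Set
PrefixNormal w = ∀ (i : ℕ) → 1 ≤ i → ∀ (j : ℕ) → ones w j i ≤ P w i

-- The Thue–Morse word is a concatenation of the blocks 01 and 10 starting at
-- even positions, so a factor of length i starting at an even position has
-- between ⌊i/2⌋ and ⌈i/2⌉ ones, and any factor of length i has at most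
-- ⌊i/2⌋ + 1 ones.  In 11tm the two leading ones raise the prefix count of
-- length i ≥ 1 to at least ⌊i/2⌋ + 1, which handles every factor lying in tm.
-- The remaining factor, starting at the second 1, is a prefix of 1tm, and the
-- prefix of 11tm of the same length adds a leading 1 while dropping only one letter.
module Submission where

open import Defs
open import Data.Bool using (true; false; not)
open import Data.Product using (_×_; _,_; ∃)
open import Data.Sum using (_⊎_; inj₁; inj₂)
open import Relation.Nullary using (¬_)
open import Data.Nat using (ℕ; zero; suc; _+_; _≤_; _<_; z≤n; s≤s; ⌊_/2⌋; ⌈_/2⌉)
open import Data.Nat.Properties
open import Data.List using ([]; _∷_; _++_; length)
open import Data.List.Properties using (concatMap-++)
open import Relation.Binary.PropositionalEquality

double : ℕ → ℕ
double zero    = zero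
double (suc k) = suc (suc (double k))

n≤double : ∀ n → n ≤ double n
n≤double zero    = z≤n
n≤double (suc n) = s≤s (m≤n⇒m≤1+n (n≤double n))

even⊎odd : ∀ n → (∃ λ k → n ≡ double k) ⊎ (∃ λ k → n ≡ suc (double k))
even⊎odd zero = inj₁ (zero , refl)
even⊎odd (suc n) with even⊎odd n
... | inj₁ (k , refl) = inj₂ (k , refl)
... | inj₂ (k , refl) = inj₁ (suc k , refl)

index-++ˡ : ∀ xs ys {k} → k < length xs → index (xs ++ ys) k ≡ index xs k
index-++ˡ (x ∷ xs) ys {zero}  _         = refl
index-++ˡ (x ∷ xs) ys {suc k} (s≤s k<n) = index-++ˡ xs ys k<n

length-μTM : ∀ xs → length (μTM xs) ≡ length xs + length xs
length-μTM []       = refl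
length-μTM (x ∷ xs) = begin
  length (μTM-letter x ++ μTM xs)    ≡⟨ length-μTM-letter x ⟩
  suc (suc (length (μTM xs)))        ≡⟨ cong (λ n → suc (suc n)) (length-μTM xs) ⟩
  suc (suc (length xs + length xs))  ≡⟨ cong suc (+-suc (length xs) (length xs)) ⟨
  suc (length xs + suc (length xs))  ∎
  where
  open ≡-Reasoning
  length-μTM-letter : ∀ x → length (μTM-letter x ++ μTM xs) ≡ suc (suc (length (μTM xs)))
  length-μTM-letter false = refl
  length-μTM-letter true  = refl

n<length-μTM^ : ∀ n → n < length (μTM^ n)
n<length-μTM^ zero    = s≤s z≤n
n<length-μTM^ (suc n) rewrite length-μTM (μTM^ n) =
  ≤-trans (s≤s (m≤n+m (suc n) n)) (+-mono-≤ (n<length-μTM^ n) (n<length-μTM^ n))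

μTM^-prefix : ∀ n → ∃ λ s → μTM^ (suc n) ≡ μTM^ n ++ s
μTM^-prefix zero = true ∷ [] , refl
μTM^-prefix (suc n) with μTM^-prefix n
... | s , eq = μTM s , trans (cong μTM eq) (concatMap-++ μTM-letter (μTM^ n) s)

index-μTM^-suc : ∀ n {k} → k < length (μTM^ n) → index (μTM^ (suc n)) k ≡ index (μTM^ n) k
index-μTM^-suc n {k} k<len with μTM^-prefix n
... | s , eq = trans (cong (λ xs → index xs k) eq) (index-++ˡ (μTM^ n) s k<len)

index-μTM-double : ∀ xs k → index (μTM xs) (double k) ≡ index xs k
index-μTM-double []           k       = refl
index-μTM-double (false ∷ xs) zero    = refl
index-μTM-double (true ∷ xs)  zero    = refl
index-μTM-double (false ∷ xs) (suc k) = index-μTM-double xs k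
index-μTM-double (true ∷ xs)  (suc k) = index-μTM-double xs k

index-μTM-suc-double : ∀ xs {k} → k < length xs → index (μTM xs) (suc (double k)) ≡ not (index xs k)
index-μTM-suc-double (false ∷ xs) {zero}  _         = refl
index-μTM-suc-double (true ∷ xs)  {zero}  _         = refl
index-μTM-suc-double (false ∷ xs) {suc k} (s≤s k<n) = index-μTM-suc-double xs k<n
index-μTM-suc-double (true ∷ xs)  {suc k} (s≤s k<n) = index-μTM-suc-double xs k<n

tm-suc-double : ∀ k → tm (suc (double k)) ≡ not (tm (double k))
tm-suc-double k = begin
  index (μTM (μTM^ (suc (double k)))) (suc (double k))  ≡⟨ index-μTM-suc-double (μTM^ (suc (double k))) (k<len (suc (double k)) (m≤n⇒m≤1+n (n≤double k))) ⟩
  not (index (μTM^ (suc (double k))) k)                 ≡⟨ cong not (index-μTM^-suc (double k) (k<len (double k) (n≤double k))) ⟩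
  not (index (μTM^ (double k)) k)                       ≡⟨ cong not (index-μTM-double (μTM^ (double k)) k) ⟨
  not (index (μTM (μTM^ (double k))) (double k))        ∎
  where
  open ≡-Reasoning
  k<len : ∀ n → k ≤ n → k < length (μTM^ n)
  k<len n k≤n = ≤-trans (s≤s k≤n) (n<length-μTM^ n)

bit≤1 : ∀ b → bit b ≤ 1
bit≤1 false = z≤n
bit≤1 true  = s≤s z≤n

bit+bit-not : ∀ b → bit b + bit (not b) ≡ 1
bit+bit-not false = refl
bit+bit-not true  = refl

ones-suc≤ : ∀ w j i → ones w j (suc i) ≤ suc (ones w j i)
ones-suc≤ w j zero    = +-monoˡ-≤ 0 (bit≤1 (w j))
ones-suc≤ w j (suc i) = ≤-trans (+-monoʳ-≤ (bit (w j)) (ones-suc≤ w (suc j) i))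
                                (≤-reflexive (+-suc (bit (w j)) (ones w (suc j) i)))

ones-∷ʷ : ∀ a w j i → ones (a ∷ʷ w) (suc j) i ≡ ones w j i
ones-∷ʷ a w j zero    = refl
ones-∷ʷ a w j (suc i) = cong (bit (w j) +_) (ones-∷ʷ a w (suc j) i)

ones-from-1≤P : ∀ w i → ones (true ∷ʷ w) 1 i ≤ P (true ∷ʷ w) i
ones-from-1≤P w zero    = z≤n
ones-from-1≤P w (suc i) = begin
  ones (true ∷ʷ w) 1 (suc i)  ≡⟨ ones-∷ʷ true w 0 (suc i) ⟩
  ones w 0 (suc i)            ≤⟨ ones-suc≤ w 0 i ⟩
  suc (ones w 0 i)            ≡⟨ cong suc (ones-∷ʷ true w 0 i) ⟨
  P (true ∷ʷ w) (suc i)       ∎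
  where open ≤-Reasoning

ones-tm-block : ∀ k i → ones tm (double k) (suc (suc i)) ≡ suc (ones tm (double (suc k)) i)
ones-tm-block k i = begin
  b + (bit (tm (suc (double k))) + rest)  ≡⟨ +-assoc b _ rest ⟨
  b + bit (tm (suc (double k))) + rest    ≡⟨ cong (λ c → b + bit c + rest) (tm-suc-double k) ⟩
  b + bit (not (tm (double k))) + rest    ≡⟨ cong (_+ rest) (bit+bit-not (tm (double k))) ⟩
  suc rest                                ∎
  where
  open ≡-Reasoning
  b = bit (tm (double k))
  rest = ones tm (double (suc k)) i

⌊i/2⌋≤ones-tm-double : ∀ k i → ⌊ i /2⌋ ≤ ones tm (double k) i
⌊i/2⌋≤ones-tm-double k zero          = z≤n
⌊i/2⌋≤ones-tm-double k (suc zero)    = z≤n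
⌊i/2⌋≤ones-tm-double k (suc (suc i)) rewrite ones-tm-block k i = s≤s (⌊i/2⌋≤ones-tm-double (suc k) i)

ones-tm-double≤⌈i/2⌉ : ∀ k i → ones tm (double k) i ≤ ⌈ i /2⌉
ones-tm-double≤⌈i/2⌉ k zero          = z≤n
ones-tm-double≤⌈i/2⌉ k (suc zero)    = +-monoˡ-≤ 0 (bit≤1 (tm (double k)))
ones-tm-double≤⌈i/2⌉ k (suc (suc i)) rewrite ones-tm-block k i = s≤s (ones-tm-double≤⌈i/2⌉ (suc k) i)

ones-tm≤1+⌊i/2⌋ : ∀ j i → ones tm j i ≤ suc ⌊ i /2⌋
ones-tm≤1+⌊i/2⌋ j i with even⊎odd j
... | inj₁ (k , refl) = ≤-trans (ones-tm-double≤⌈i/2⌉ k i) (⌊n/2⌋-mono (n≤1+n (suc i)))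
ones-tm≤1+⌊i/2⌋ j zero    | inj₂ (k , refl) = z≤n
ones-tm≤1+⌊i/2⌋ j (suc i) | inj₂ (k , refl) =
  +-mono-≤ (bit≤1 (tm (suc (double k)))) (ones-tm-double≤⌈i/2⌉ (suc k) i)

ones-11tm : ∀ j i → ones (true ∷ʷ true ∷ʷ tm) (suc (suc j)) i ≡ ones tm j i
ones-11tm j i = trans (ones-∷ʷ true (true ∷ʷ tm) (suc j) i) (ones-∷ʷ true tm j i)

1+⌊i/2⌋≤P-11tm : ∀ i → 1 ≤ i → suc ⌊ i /2⌋ ≤ P (true ∷ʷ true ∷ʷ tm) i
1+⌊i/2⌋≤P-11tm (suc zero)    _ = ≤-refl
1+⌊i/2⌋≤P-11tm (suc (suc i)) _ rewrite ones-11tm 0 i = s≤s (s≤s (⌊i/2⌋≤ones-tm-double 0 i))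

prefixNormal-11tm : PrefixNormal (true ∷ʷ true ∷ʷ tm)
prefixNormal-11tm i _   zero          = ≤-refl
prefixNormal-11tm i _   (suc zero)    = ones-from-1≤P (true ∷ʷ tm) i
prefixNormal-11tm i 1≤i (suc (suc j)) = begin
  ones (true ∷ʷ true ∷ʷ tm) (suc (suc j)) i  ≡⟨ ones-11tm j i ⟩
  ones tm j i                                ≤⟨ ones-tm≤1+⌊i/2⌋ j i ⟩
  suc ⌊ i /2⌋                                ≤⟨ 1+⌊i/2⌋≤P-11tm i 1≤i ⟩
  P (true ∷ʷ true ∷ʷ tm) i                   ∎
  where open ≤-Reasoning

lemma10 : PrefixNormal (true ∷ʷ true ∷ʷ tm) × ¬ PrefixNormal (true ∷ʷ tm)
lemma10 = prefixNormal-11tm , λ normal → 2≰1 (normal 2 (s≤s z≤n) 2)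
  where
  -- 1tm begins 1011, so the factor of length 2 at position 2 has two ones and the prefix one.
  2≰1 : ¬ (2 ≤ 1)
  2≰1 (s≤s ())
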